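{- Let $M$ be a matroid on $E$ and let $\{i,j\}$ be a circuit of $M$. If $\nu,\nu'$ are valuations of $M$ with $\nu\setminus j=\nu'\setminus j$, then $\nu\sim\nu'$.
   Context: A matroid valuation is $\nu:\binom{E}{d}\to\mathbb{R}\cup\{\infty\}$ with (V1) $\nu(B)<\infty$ for some $B$; (V2) for all $B,B'$ and $i\in B\setminus B'$ there is $j\in B'\setminus B$ with $\nu(B)+\nu(B')\ge\nu(B-i+j)+\nu(B'+i-j)$; it is a valuation of $M$ if $\{B:\nu(B)<\infty\}$ is the set of bases of $M$. $\nu\setminus j$ is the restriction of $\nu$ to $\binom{E-j}{d}$. $\nu\sim\nu'$ means there is $\alpha\in\mathbb{R}^E$ with $\nu(B)=\nu'(B)+\sum_{k\in B}\alpha_k$ for all $B\in\binom{E}{d}$. -}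

module Defs where

open import Level using (Level; suc; _⊔_)
open import Data.Nat using (ℕ)
open import Data.Fin using (Fin)
open import Data.Fin.Subset using (Subset; _∈_; _∉_; _⊆_; _⊂_; ⁅_⁆; _∪_; _-_; ∣_∣)
open import Data.Bool using (true; false)
open import Data.Vec using ([]; _∷_)
open import Data.Maybe using (Maybe; just; nothing)
open import Data.Product using (Σ; ∃; _×_; _,_)
open import Data.Sum using (_⊎_)
open import Data.Empty using (⊥)
open import Relation.Nullary using (¬_)
open import Relation.Binary.PropositionalEquality using (_≡_; _≢_)

-- Value group: a totally ordered abelian group (ℝ is the paper's
-- instance; ℝ is not available in agda-stdlib, so we work over an
-- arbitrary totally ordered abelian group).

record OrderedAbGroup (a : Level) : Set (suc a) where
  infixl 6 _+_
  infix 4 _≤_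
  field
    Carrier : Set a
    _+_     : Carrier → Carrier → Carrier
    0#      : Carrier
    -_      : Carrier → Carrier
    _≤_     : Carrier → Carrier → Set a
    +-assoc    : ∀ x y z → (x + y) + z ≡ x + (y + z)
    +-comm     : ∀ x y → x + y ≡ y + x
    +-identityˡ : ∀ x → 0# + x ≡ x
    -‿inverseˡ : ∀ x → (- x) + x ≡ 0#
    ≤-refl     : ∀ x → x ≤ x
    ≤-trans    : ∀ {x y z} → x ≤ y → y ≤ z → x ≤ z
    ≤-antisym  : ∀ {x y} → x ≤ y → y ≤ x → x ≡ y
    ≤-total    : ∀ x y → x ≤ y ⊎ y ≤ x
    +-monoˡ-≤  : ∀ {x y} z → x ≤ y → x + z ≤ y + z

module _ {a : Level} (G : OrderedAbGroup a) where
  open OrderedAbGroup G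

  -- G ∪ {∞}, with ∞ = nothing
  G∞ : Set a
  G∞ = Maybe Carrier

  infixl 6 _+∞_
  _+∞_ : G∞ → G∞ → G∞
  just x +∞ just y = just (x + y)
  _      +∞ _      = nothing

  infix 4 _≤∞_
  data _≤∞_ : G∞ → G∞ → Set a where
    fin≤fin : ∀ {x y} → x ≤ y → just x ≤∞ just y
    _≤∞top  : ∀ u → u ≤∞ nothing

  sumOver : ∀ {n} → Subset n → (Fin n → Carrier) → Carrier
  sumOver []            α = 0#
  sumOver (true  ∷ B)   α = α Fin.zero + sumOver B (λ k → α (Fin.suc k))
  sumOver (false ∷ B)   α = sumOver B (λ k → α (Fin.suc k))

  -- ν : binom(E,d) → G ∪ {∞}, represented as a function on all subsets of
  -- E = Fin n of which only the d-subsets are ever consulted.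
  record IsValuation {n : ℕ} (d : ℕ) (ν : Subset n → G∞) : Set a where
    field
      V1 : Σ (Subset n) λ B → ∣ B ∣ ≡ d × Σ Carrier λ x → ν B ≡ just x
      V2 : ∀ B B' → ∣ B ∣ ≡ d → ∣ B' ∣ ≡ d → ∀ i → i ∈ B → i ∉ B' →
           Σ (Fin n) λ j → j ∈ B' × j ∉ B ×
             (ν ((B - i) ∪ ⁅ j ⁆) +∞ ν ((B' ∪ ⁅ i ⁆) - j) ≤∞ ν B +∞ ν B')

record Matroid (n : ℕ) : Set₁ where
  field
    IsBase   : Subset n → Set
    nonempty : Σ (Subset n) IsBase
    exchange : ∀ B B' → IsBase B → IsBase B' → ∀ x → x ∈ B → x ∉ B' →
               Σ (Fin n) λ y → y ∈ B' × y ∉ B × IsBase ((B - x) ∪ ⁅ y ⁆)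

  Independent : Subset n → Set
  Independent X = Σ (Subset n) λ B → IsBase B × X ⊆ B

  Dependent : Subset n → Set
  Dependent X = ¬ Independent X

  IsCircuit : Subset n → Set
  IsCircuit C = Dependent C × (∀ D → D ⊂ C → Independent D)

module _ {a : Level} (G : OrderedAbGroup a) where
  open OrderedAbGroup G

  record IsValuationOf {n : ℕ} (M : Matroid n) (d : ℕ) (ν : Subset n → G∞ G) : Set (a ⊔ suc Level.zero) where
    field
      isValuation : IsValuation G d ν
      bases       : ∀ B → (Matroid.IsBase M B →
                             ∣ B ∣ ≡ d × Σ Carrier λ x → ν B ≡ just x)
                        × (∣ B ∣ ≡ d → Σ Carrier (λ x → ν B ≡ just x) →
                             Matroid.IsBase M B)

  -- ν ∖ j = ν' ∖ j : agree on all d-subsets of E - j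
  DeleteEq : ∀ {n} (d : ℕ) (j : Fin n) (ν ν' : Subset n → G∞ G) → Set a
  DeleteEq d j ν ν' = ∀ B → ∣ B ∣ ≡ d → j ∉ B → ν B ≡ ν' B

  Equiv : ∀ {n} (d : ℕ) (ν ν' : Subset n → G∞ G) → Set a
  Equiv {n} d ν ν' = Σ (Fin n → Carrier) λ α →
    ∀ B → ∣ B ∣ ≡ d → ν B ≡ _+∞_ G (ν' B) (just (sumOver G B α))

module Submission where

-- Then ν ∼ ν', the witness being the vector
-- α = δ · e_j that is zero off j, for a suitable constant δ.
--
-- If i ≡ j then j is a loop: no base contains j, so ν and ν' are both ∞
-- on every d-set through j and δ = 0 works.
--
-- If i ≢ j then i and j are parallel, and for a base B ∋ j its swap
-- B - j + i is again a base (the valuation exchange axiom forces it).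
-- Applying the exchange axiom to B₁ and the swap of B₂ (and vice versa)
-- shows that ν B - ν (swap B) does not depend on the base B ∋ j.  Since
-- swap B avoids j, ν and ν' agree there, so ν B - ν' B is a constant δ on
-- the bases through j.

open import Defs
open import Level using (Level)
open import Data.Nat using (ℕ)
open import Data.Fin using (Fin)
open import Data.Fin.Subset using (Subset; ⁅_⁆; _∪_)

open import Data.Nat using (suc)
open import Data.Nat.Properties using (suc-injective)
open import Data.Fin using (zero; suc)
open import Data.Fin.Properties using (_≟_)
open import Data.Fin.Subset using (_∈_; _∉_; _─_; _-_; ∣_∣; _⊆_)
open import Data.Fin.Subset.Properties
  using (x∈p∪q⁻; x∈p∪q⁺; x∈⁅y⁆⇒x≡y; x∈⁅x⁆; x∈p∧x≢y⇒x∈p-y; ⊆-antisym; _∈?_;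
         p─q⊆p; p─⊥≡p; ∪-identityʳ)
open import Data.Bool using (true; false)
open import Data.Vec using ([]; _∷_; here; there)
open import Data.Maybe using (just; nothing)
open import Data.Product using (Σ; _×_; _,_; proj₁; proj₂)
open import Data.Sum using (_⊎_; inj₁; inj₂)
open import Data.Empty using (⊥; ⊥-elim)
open import Relation.Nullary using (¬_; yes; no)
open import Relation.Binary.PropositionalEquality

x∈p─q⇒x∉q : ∀ {n} (p q : Subset n) {x : Fin n} → x ∈ p ─ q → x ∉ q
x∈p─q⇒x∉q (s ∷ p) (true ∷ q) () here
x∈p─q⇒x∉q (s ∷ p) (t ∷ q) (there x∈) (there x∈q) = x∈p─q⇒x∉q p q x∈ x∈q

∈-delete⁻ : ∀ {n} {p : Subset n} {x y : Fin n} → x ∈ p - y → x ∈ p × x ≢ y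
∈-delete⁻ {p = p} {x} {y} x∈ =
  p─q⊆p p ⁅ y ⁆ x∈ , λ { refl → x∈p─q⇒x∉q p ⁅ y ⁆ x∈ (x∈⁅x⁆ y) }

∉-delete : ∀ {n} (p : Subset n) (y : Fin n) → y ∉ p - y
∉-delete p y y∈ = proj₂ (∈-delete⁻ y∈) refl

∈-insert⁻ : ∀ {n} {p : Subset n} {x y : Fin n} → x ∈ p ∪ ⁅ y ⁆ → x ∈ p ⊎ x ≡ y
∈-insert⁻ {p = p} {y = y} x∈ with x∈p∪q⁻ p ⁅ y ⁆ x∈
... | inj₁ x∈p = inj₁ x∈p
... | inj₂ x∈y = inj₂ (x∈⁅y⁆⇒x≡y y x∈y)

∈-insert-old : ∀ {n} {p : Subset n} {x y : Fin n} → x ∈ p → x ∈ p ∪ ⁅ y ⁆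
∈-insert-old x∈p = x∈p∪q⁺ (inj₁ x∈p)

∈-insert-new : ∀ {n} {p : Subset n} (y : Fin n) → y ∈ p ∪ ⁅ y ⁆
∈-insert-new y = x∈p∪q⁺ (inj₂ (x∈⁅x⁆ y))

pair⊆ : ∀ {n} {X : Subset n} {x y : Fin n} → x ∈ X → y ∈ X → ⁅ x ⁆ ∪ ⁅ y ⁆ ⊆ X
pair⊆ {x = x} {y} x∈X y∈X z∈ with x∈p∪q⁻ ⁅ x ⁆ ⁅ y ⁆ z∈
... | inj₁ z∈x rewrite x∈⁅y⁆⇒x≡y x z∈x = x∈X
... | inj₂ z∈y rewrite x∈⁅y⁆⇒x≡y y z∈y = y∈X

∣insert∣ : ∀ {n} (p : Subset n) (x : Fin n) → x ∉ p → ∣ p ∪ ⁅ x ⁆ ∣ ≡ suc ∣ p ∣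
∣insert∣ (true  ∷ p) zero    x∉ = ⊥-elim (x∉ here)
∣insert∣ (false ∷ p) zero    x∉ = cong (λ q → suc ∣ q ∣) (∪-identityʳ p)
∣insert∣ (true  ∷ p) (suc x) x∉ = cong suc (∣insert∣ p x (λ x∈ → x∉ (there x∈)))
∣insert∣ (false ∷ p) (suc x) x∉ = ∣insert∣ p x (λ x∈ → x∉ (there x∈))

∣delete∣ : ∀ {n} (p : Subset n) (x : Fin n) → x ∈ p → suc ∣ p - x ∣ ≡ ∣ p ∣
∣delete∣ (true  ∷ p) zero    here       = cong (λ q → suc ∣ q ∣) (p─⊥≡p p)
∣delete∣ (true  ∷ p) (suc x) (there x∈) = cong suc (∣delete∣ p x x∈)
∣delete∣ (false ∷ p) (suc x) (there x∈) = ∣delete∣ p x x∈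

∣exchange∣ : ∀ {n} {p : Subset n} {x y : Fin n} → x ∉ p → y ∈ p ∪ ⁅ x ⁆ →
             ∣ (p ∪ ⁅ x ⁆) - y ∣ ≡ ∣ p ∣
∣exchange∣ {p = p} {x} {y} x∉ y∈ =
  suc-injective (trans (∣delete∣ (p ∪ ⁅ x ⁆) y y∈) (∣insert∣ p x x∉))

exchange-keeps : ∀ {n} {p : Subset n} {x y z : Fin n} → z ∈ p → z ≢ y →
                 z ∈ (p ∪ ⁅ x ⁆) - y
exchange-keeps z∈ z≢y = x∈p∧x≢y⇒x∈p-y (∈-insert-old z∈) z≢y

exchange-adds : ∀ {n} {p : Subset n} {x y : Fin n} → x ∉ p → y ∈ p →
                x ∈ (p ∪ ⁅ x ⁆) - y
exchange-adds {x = x} x∉ y∈ = x∈p∧x≢y⇒x∈p-y (∈-insert-new x) λ { refl → x∉ y∈ }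

delete-insert-comm : ∀ {n} (p : Subset n) {x y : Fin n} → x ≢ y →
                     (p - y) ∪ ⁅ x ⁆ ≡ (p ∪ ⁅ x ⁆) - y
delete-insert-comm p {x} {y} x≢y = ⊆-antisym to from
  where
  to : (p - y) ∪ ⁅ x ⁆ ⊆ (p ∪ ⁅ x ⁆) - y
  to z∈ with ∈-insert⁻ z∈
  ... | inj₁ z∈p-y = exchange-keeps (proj₁ (∈-delete⁻ z∈p-y)) (proj₂ (∈-delete⁻ z∈p-y))
  ... | inj₂ refl  = x∈p∧x≢y⇒x∈p-y (∈-insert-new x) x≢y
  from : (p ∪ ⁅ x ⁆) - y ⊆ (p - y) ∪ ⁅ x ⁆
  from z∈ with ∈-delete⁻ z∈
  ... | z∈p∪x , z≢y with ∈-insert⁻ z∈p∪x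
  ... | inj₁ z∈p = ∈-insert-old (x∈p∧x≢y⇒x∈p-y z∈p z≢y)
  ... | inj₂ refl = ∈-insert-new x

exchange-involutive : ∀ {n} (p : Subset n) {x y : Fin n} → y ∈ p → x ∉ p →
                      (((p ∪ ⁅ x ⁆) - y) ∪ ⁅ y ⁆) - x ≡ p
exchange-involutive p {x} {y} y∈ x∉ = ⊆-antisym to from
  where
  to : (((p ∪ ⁅ x ⁆) - y) ∪ ⁅ y ⁆) - x ⊆ p
  to z∈ with ∈-delete⁻ z∈
  ... | z∈q , z≢x with ∈-insert⁻ z∈q
  ... | inj₂ refl = y∈
  ... | inj₁ z∈r with ∈-insert⁻ (proj₁ (∈-delete⁻ z∈r))
  ... | inj₁ z∈p = z∈p
  ... | inj₂ z≡x = ⊥-elim (z≢x z≡x)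
  from : p ⊆ (((p ∪ ⁅ x ⁆) - y) ∪ ⁅ y ⁆) - x
  from {z} z∈p with z ≟ y
  ... | yes refl = x∈p∧x≢y⇒x∈p-y (∈-insert-new y) λ { refl → x∉ z∈p }
  ... | no z≢y   = exchange-keeps (exchange-keeps z∈p z≢y) λ { refl → x∉ z∈p }

module GroupFacts {a : Level} (G : OrderedAbGroup a) where
  open OrderedAbGroup G

  infixl 6 _⊕_
  _⊕_ : G∞ G → G∞ G → G∞ G
  _⊕_ = _+∞_ G

  +-identityʳ : ∀ x → x + 0# ≡ x
  +-identityʳ x = trans (+-comm x 0#) (+-identityˡ x)

  -‿inverseʳ : ∀ x → x + (- x) ≡ 0#
  -‿inverseʳ x = trans (+-comm x (- x)) (-‿inverseˡ x)

  +-rightComm : ∀ x y z → (x + y) + z ≡ (x + z) + y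
  +-rightComm x y z =
    trans (+-assoc x y z) (trans (cong (x +_) (+-comm y z)) (sym (+-assoc x z y)))

  +-‿cancelʳ : ∀ x z → (x + z) + - z ≡ x
  +-‿cancelʳ x z = trans (+-assoc x z (- z))
                         (trans (cong (x +_) (-‿inverseʳ z)) (+-identityʳ x))

  +-cancelʳ : ∀ {x y} z → x + z ≡ y + z → x ≡ y
  +-cancelʳ {x} {y} z e = begin
    x              ≡⟨ sym (+-‿cancelʳ x z) ⟩
    (x + z) + - z  ≡⟨ cong (_+ - z) e ⟩
    (y + z) + - z  ≡⟨ +-‿cancelʳ y z ⟩
    y              ∎
    where open ≡-Reasoning

  difference-transfer : ∀ {x x' y z b b'} → y + b ≡ x + z → y + b' ≡ x' + z →
                        x ≡ x' + (b + - b')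
  difference-transfer {x} {x'} {y} {z} {b} {b'} e e' = begin
    x                  ≡⟨ sym (+-‿cancelʳ x b') ⟩
    (x + b') + - b'    ≡⟨ cong (_+ - b') x+b'≡x'+b ⟩
    (x' + b) + - b'    ≡⟨ +-assoc x' b (- b') ⟩
    x' + (b + - b')    ∎
    where
    open ≡-Reasoning
    x+b'≡x'+b : x + b' ≡ x' + b
    x+b'≡x'+b = +-cancelʳ z (begin
      (x + b') + z   ≡⟨ +-rightComm x b' z ⟩
      (x + z) + b'   ≡⟨ cong (_+ b') (sym e) ⟩
      (y + b) + b'   ≡⟨ +-rightComm y b b' ⟩
      (y + b') + b   ≡⟨ cong (_+ b) e' ⟩
      (x' + z) + b   ≡⟨ +-rightComm x' z b ⟩
      (x' + b) + z   ∎)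

  ⊕-identityʳ : ∀ u → u ⊕ just 0# ≡ u
  ⊕-identityʳ nothing  = refl
  ⊕-identityʳ (just x) = cong just (+-identityʳ x)

  ⊕-bounded⁻ : ∀ u v z → _≤∞_ G (u ⊕ v) (just z) →
               Σ Carrier λ x → u ≡ just x × Σ Carrier λ y → v ≡ just y × x + y ≤ z
  ⊕-bounded⁻ (just x) (just y) z (fin≤fin x+y≤z) = x , refl , y , refl , x+y≤z

  pointMass : ∀ {n} → Fin n → Carrier → Fin n → Carrier
  pointMass zero    δ zero    = δ
  pointMass zero    δ (suc k) = 0#
  pointMass (suc j) δ zero    = 0#
  pointMass (suc j) δ (suc k) = pointMass j δ k

  sumOver-zero : ∀ {n} (B : Subset n) → sumOver G B (λ _ → 0#) ≡ 0#
  sumOver-zero []          = refl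
  sumOver-zero (true ∷ B)  = trans (cong (0# +_) (sumOver-zero B)) (+-identityˡ 0#)
  sumOver-zero (false ∷ B) = sumOver-zero B

  sumOver-pointMass-∈ : ∀ {n} (B : Subset n) (j : Fin n) δ → j ∈ B →
                        sumOver G B (pointMass j δ) ≡ δ
  sumOver-pointMass-∈ (true ∷ B) zero δ here =
    trans (cong (δ +_) (sumOver-zero B)) (+-identityʳ δ)
  sumOver-pointMass-∈ (true ∷ B) (suc j) δ (there j∈) =
    trans (cong (0# +_) (sumOver-pointMass-∈ B j δ j∈)) (+-identityˡ δ)
  sumOver-pointMass-∈ (false ∷ B) (suc j) δ (there j∈) = sumOver-pointMass-∈ B j δ j∈

  sumOver-pointMass-∉ : ∀ {n} (B : Subset n) (j : Fin n) δ → j ∉ B →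
                        sumOver G B (pointMass j δ) ≡ 0#
  sumOver-pointMass-∉ (true ∷ B) zero δ j∉ = ⊥-elim (j∉ here)
  sumOver-pointMass-∉ (false ∷ B) zero δ j∉ = sumOver-zero B
  sumOver-pointMass-∉ (true ∷ B) (suc j) δ j∉ =
    trans (cong (0# +_) (sumOver-pointMass-∉ B j δ (λ j∈ → j∉ (there j∈)))) (+-identityˡ 0#)
  sumOver-pointMass-∉ (false ∷ B) (suc j) δ j∉ =
    sumOver-pointMass-∉ B j δ (λ j∈ → j∉ (there j∈))

module CircuitFacts {n : ℕ} (M : Matroid n) where
  open Matroid M

  circuit⊈base : ∀ {C X} → IsCircuit C → IsBase X → ¬ (C ⊆ X)
  circuit⊈base (dependent , _) bX C⊆X = dependent (_ , bX , C⊆X)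

  -- An element of a circuit with at least two elements lies in a base,
  -- because the singleton is a proper, hence independent, subset.
  memberOfSomeBase : ∀ {C x y} → IsCircuit C → x ∈ C → y ∈ C → x ≢ y →
                     Σ (Subset n) λ B → IsBase B × x ∈ B
  memberOfSomeBase {C} {x} {y} (_ , minimal) x∈C y∈C x≢y
    with minimal ⁅ x ⁆ (x⊆C , y , y∈C , λ y∈x → x≢y (sym (x∈⁅y⁆⇒x≡y x y∈x)))
    where
    x⊆C : ⁅ x ⁆ ⊆ C
    x⊆C z∈x rewrite x∈⁅y⁆⇒x≡y x z∈x = x∈C
  ... | B , bB , x⊆B = B , bB , x⊆B (x∈⁅x⁆ x)

module ValuationFacts {a : Level} (G : OrderedAbGroup a) {n : ℕ} (d : ℕ) (M : Matroid n)
    (ν : Subset n → G∞ G) (V : IsValuationOf G M d ν) where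
  open OrderedAbGroup G
  open Matroid M
  open GroupFacts G
  open IsValuationOf V
  open IsValuation isValuation

  base⇒finite : ∀ {B} → IsBase B → ∣ B ∣ ≡ d × Σ Carrier λ x → ν B ≡ just x
  base⇒finite {B} = proj₁ (bases B)

  finite⇒base : ∀ {B x} → ∣ B ∣ ≡ d → ν B ≡ just x → IsBase B
  finite⇒base {B} {x} sB eB = proj₂ (bases B) sB (x , eB)

  base-or-infinite : ∀ {B} → ∣ B ∣ ≡ d → IsBase B ⊎ ν B ≡ nothing
  base-or-infinite {B} sB with ν B in eB
  ... | just _  = inj₁ (finite⇒base sB eB)
  ... | nothing = inj₂ refl

  infinite⇒nonBase : ∀ {B} → ν B ≡ nothing → ¬ IsBase B
  infinite⇒nonBase ν∞ bB with base⇒finite bB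
  ... | _ , _ , eB with trans (sym ν∞) eB
  ... | ()

  nonBase⇒infinite : ∀ {B} → ∣ B ∣ ≡ d → ¬ IsBase B → ν B ≡ nothing
  nonBase⇒infinite sB nonBase with base-or-infinite sB
  ... | inj₁ bB = ⊥-elim (nonBase bB)
  ... | inj₂ ν∞ = ν∞

  forcedExchange : ∀ {B B' x x' l} → ∣ B ∣ ≡ d → ∣ B' ∣ ≡ d →
    ν B ≡ just x → ν B' ≡ just x' → l ∈ B → l ∉ B' → ∀ k₀ →
    (∀ k → k ∈ B' → k ≢ k₀ → ¬ IsBase ((B' ∪ ⁅ l ⁆) - k)) →
    Σ Carrier λ u → ν ((B - l) ∪ ⁅ k₀ ⁆) ≡ just u ×
      Σ Carrier λ w → ν ((B' ∪ ⁅ l ⁆) - k₀) ≡ just w × u + w ≤ x + x'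
  forcedExchange {B} {B'} {x} {x'} {l} sB sB' eB eB' l∈B l∉B' k₀ onlyK₀
    with V2 B B' sB sB' l l∈B l∉B'
  ... | k , k∈B' , _ , exch
    with ⊕-bounded⁻ (ν ((B - l) ∪ ⁅ k ⁆)) (ν ((B' ∪ ⁅ l ⁆) - k)) (x + x')
           (subst (_≤∞_ G _) (cong₂ _⊕_ eB eB') exch)
  ... | u , eu , w , ew , u+w≤ with k ≟ k₀
  ... | yes refl = u , eu , w , ew , u+w≤
  ... | no k≢k₀  = ⊥-elim (onlyK₀ k k∈B' k≢k₀ (finite⇒base sizeOk ew))
    where
    sizeOk : ∣ (B' ∪ ⁅ l ⁆) - k ∣ ≡ d
    sizeOk = trans (∣exchange∣ l∉B' (∈-insert-old k∈B')) sB'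

-- Two valuations of M that agree off j and differ by a constant δ on every
-- base through j are equivalent, with α = δ · e_j.  (Non-bases through j
-- have value ∞ under both.)

equivalent-if-shifted : {a : Level} (G : OrderedAbGroup a) {n : ℕ} (d : ℕ) (M : Matroid n)
  {ν ν' : Subset n → G∞ G} → IsValuationOf G M d ν → IsValuationOf G M d ν' →
  (j : Fin n) → DeleteEq G d j ν ν' → (δ : OrderedAbGroup.Carrier G) →
  (∀ B → Matroid.IsBase M B → j ∈ B → ν B ≡ _+∞_ G (ν' B) (just δ)) →
  Equiv G d ν ν'
equivalent-if-shifted G d M {ν} {ν'} V V' j agree δ shifted = pointMass j δ , equal
  where
  open GroupFacts G
  module F  = ValuationFacts G d M ν V
  module F' = ValuationFacts G d M ν' V'
  equal : ∀ B → ∣ B ∣ ≡ d → ν B ≡ ν' B ⊕ just (sumOver G B (pointMass j δ))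
  equal B sB with j ∈? B
  ... | no j∉B
    rewrite sumOver-pointMass-∉ B j δ j∉B | ⊕-identityʳ (ν' B) = agree B sB j∉B
  ... | yes j∈B rewrite sumOver-pointMass-∈ B j δ j∈B with F'.base-or-infinite sB
  ... | inj₁ bB = shifted B bB j∈B
  ... | inj₂ ν'∞ rewrite ν'∞ = F.nonBase⇒infinite sB (F'.infinite⇒nonBase ν'∞)

module ParallelPair {a : Level} (G : OrderedAbGroup a) {n : ℕ} (d : ℕ) (M : Matroid n)
    (i j : Fin n) (circuit : Matroid.IsCircuit M (⁅ i ⁆ ∪ ⁅ j ⁆)) (i≢j : i ≢ j) where
  open OrderedAbGroup G
  open Matroid M
  open CircuitFacts M
  open GroupFacts G

  swap : Subset n → Subset n
  swap B = (B ∪ ⁅ i ⁆) - j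

  i∈circuit : i ∈ ⁅ i ⁆ ∪ ⁅ j ⁆
  i∈circuit = ∈-insert-old (x∈⁅x⁆ i)

  j∈circuit : j ∈ ⁅ i ⁆ ∪ ⁅ j ⁆
  j∈circuit = ∈-insert-new j

  notBoth : ∀ {X} → IsBase X → i ∈ X → j ∈ X → ⊥
  notBoth bX i∈X j∈X = circuit⊈base circuit bX (pair⊆ i∈X j∈X)

  i∉base : ∀ {B} → IsBase B → j ∈ B → i ∉ B
  i∉base bB j∈B i∈B = notBoth bB i∈B j∈B

  i∈swap : ∀ B → i ∈ swap B
  i∈swap B = x∈p∧x≢y⇒x∈p-y (∈-insert-new i) i≢j

  j∉swap : ∀ B → j ∉ swap B
  j∉swap B = ∉-delete (B ∪ ⁅ i ⁆) j

  module SwapFacts (ν : Subset n → G∞ G) (V : IsValuationOf G M d ν) where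
    open ValuationFacts G d M ν V

    swap-size : ∀ {B} → IsBase B → j ∈ B → ∣ swap B ∣ ≡ d
    swap-size bB j∈B = trans (∣exchange∣ (i∉base bB j∈B) (∈-insert-old j∈B))
                             (proj₁ (base⇒finite bB))

    -- The swap of a base through j has finite value (so is a base):
    -- exchanging i out of a base through i into B can only remove j.
    swapFinite : ∀ {B} → IsBase B → j ∈ B → Σ Carrier λ y → ν (swap B) ≡ just y
    swapFinite {B} bB j∈B with memberOfSomeBase circuit i∈circuit j∈circuit i≢j
    ... | Bᵢ , bBᵢ , i∈Bᵢ with base⇒finite bBᵢ | base⇒finite bB
    ... | sBᵢ , _ , eBᵢ | sB , _ , eB
      with forcedExchange sBᵢ sB eBᵢ eB i∈Bᵢ (i∉base bB j∈B) j
             (λ k k∈B k≢j bK → notBoth bK (exchange-adds (i∉base bB j∈B) k∈B)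
                                          (exchange-keeps j∈B λ { refl → k≢j refl }))
    ... | _ , _ , w , ew , _ = w , ew

    -- ν (swap B₁) + ν B₂ ≤ ν B₁ + ν (swap B₂): exchange j out of B₁ into
    -- swap B₂; only i can leave, and the results are swap B₁ and B₂.
    swapExchange : ∀ {B₁ B₂ x₁ y₁ x₂ y₂} → IsBase B₁ → IsBase B₂ → j ∈ B₁ → j ∈ B₂ →
      ν B₁ ≡ just x₁ → ν (swap B₁) ≡ just y₁ → ν B₂ ≡ just x₂ → ν (swap B₂) ≡ just y₂ →
      y₁ + x₂ ≤ x₁ + y₂
    swapExchange {B₁} {B₂} {x₁} {y₁} {x₂} {y₂} bB₁ bB₂ j∈B₁ j∈B₂ e₁ f₁ e₂ f₂
      with forcedExchange (proj₁ (base⇒finite bB₁)) (swap-size bB₂ j∈B₂) e₁ f₂ j∈B₁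
             (j∉swap B₂) i
             (λ k k∈ k≢i bK → notBoth bK (exchange-keeps (i∈swap B₂) λ { refl → k≢i refl })
                                         (exchange-adds (j∉swap B₂) k∈))
    ... | u , eu , w , ew , u+w≤ = subst₂ (λ p q → p + q ≤ x₁ + y₂) u≡y₁ w≡x₂ u+w≤
      where
      just-injective : ∀ {p q : Carrier} → just p ≡ just q → p ≡ q
      just-injective refl = refl
      u≡y₁ : u ≡ y₁
      u≡y₁ = just-injective (trans (sym eu) (trans (cong ν (delete-insert-comm B₁ i≢j)) f₁))
      w≡x₂ : w ≡ x₂
      w≡x₂ = just-injective
        (trans (sym ew) (trans (cong ν (exchange-involutive B₂ j∈B₂ (i∉base bB₂ j∈B₂))) e₂))

    -- Hence ν B - ν (swap B) is the same for all bases B through j.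
    swapBalance : ∀ {B₁ B₂ x₁ y₁ x₂ y₂} → IsBase B₁ → IsBase B₂ → j ∈ B₁ → j ∈ B₂ →
      ν B₁ ≡ just x₁ → ν (swap B₁) ≡ just y₁ → ν B₂ ≡ just x₂ → ν (swap B₂) ≡ just y₂ →
      y₁ + x₂ ≡ x₁ + y₂
    swapBalance {x₁ = x₁} {y₁} {x₂} {y₂} bB₁ bB₂ j∈B₁ j∈B₂ e₁ f₁ e₂ f₂ =
      ≤-antisym (swapExchange bB₁ bB₂ j∈B₁ j∈B₂ e₁ f₁ e₂ f₂)
        (subst₂ _≤_ (+-comm y₂ x₁) (+-comm x₂ y₁)
          (swapExchange bB₂ bB₁ j∈B₂ j∈B₁ e₂ f₂ e₁ f₁))

  -- If ν ∖ j = ν' ∖ j then ν B - ν' B is one constant δ for all bases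
  -- B ∋ j: both differ from the common value on swap B by a constant.
  module Shift {ν ν' : Subset n → G∞ G} (V : IsValuationOf G M d ν)
      (V' : IsValuationOf G M d ν') (agree : DeleteEq G d j ν ν') where
    private
      module F  = ValuationFacts G d M ν V
      module F' = ValuationFacts G d M ν' V'
      module S  = SwapFacts ν V
      module S' = SwapFacts ν' V'

    swapValue : ∀ {B} → IsBase B → j ∈ B →
                Σ Carrier λ y → ν (swap B) ≡ just y × ν' (swap B) ≡ just y
    swapValue bB j∈B with S.swapFinite bB j∈B
    ... | y , ey = y , ey , trans (sym (agree _ (S.swap-size bB j∈B) (j∉swap _))) ey

    constantShift : Σ Carrier λ δ → ∀ B → IsBase B → j ∈ B → ν B ≡ ν' B ⊕ just δ
    constantShift
      with memberOfSomeBase circuit j∈circuit i∈circuit (λ j≡i → i≢j (sym j≡i))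
    ... | B₀ , bB₀ , j∈B₀ with F.base⇒finite bB₀ | F'.base⇒finite bB₀ | swapValue bB₀ j∈B₀
    ... | _ , x₀ , e₀ | _ , x₀' , e₀' | _ , f₀ , f₀' = x₀ + - x₀' , shifted
      where
      shifted : ∀ B → IsBase B → j ∈ B → ν B ≡ ν' B ⊕ just (x₀ + - x₀')
      shifted B bB j∈B with F.base⇒finite bB | F'.base⇒finite bB | swapValue bB j∈B
      ... | _ , x , e | _ , x' , e' | _ , f , f' = begin
        ν B                         ≡⟨ e ⟩
        just x                      ≡⟨ cong just (difference-transfer
                                         (S.swapBalance bB bB₀ j∈B j∈B₀ e f e₀ f₀)
                                         (S'.swapBalance bB bB₀ j∈B j∈B₀ e' f' e₀' f₀')) ⟩
        just x' ⊕ just (x₀ + - x₀') ≡⟨ cong (_⊕ just (x₀ + - x₀')) (sym e') ⟩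
        ν' B ⊕ just (x₀ + - x₀')    ∎
        where open ≡-Reasoning

-- For any circuit {i, j}: if ν ∖ j = ν' ∖ j, then ν - ν' is constant on the
-- bases through j.  A loop (i ≡ j) lies in no base, so this is vacuous;
-- otherwise it is the parallel case.
circuitShift : {a : Level} (G : OrderedAbGroup a) {n : ℕ} (d : ℕ) (M : Matroid n)
  (i j : Fin n) → Matroid.IsCircuit M (⁅ i ⁆ ∪ ⁅ j ⁆) →
  {ν ν' : Subset n → G∞ G} → IsValuationOf G M d ν → IsValuationOf G M d ν' →
  DeleteEq G d j ν ν' →
  Σ (OrderedAbGroup.Carrier G) λ δ →
    ∀ B → Matroid.IsBase M B → j ∈ B → ν B ≡ _+∞_ G (ν' B) (just δ)
circuitShift G d M i j circuit V V' agree with i ≟ j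
... | yes refl = OrderedAbGroup.0# G ,
  λ B bB j∈B → ⊥-elim (CircuitFacts.circuit⊈base M circuit bB (pair⊆ j∈B j∈B))
... | no i≢j = ParallelPair.Shift.constantShift G d M i j circuit i≢j V V' agree

lemma5p12 : {a : Level} (G : OrderedAbGroup a) {n : ℕ} (d : ℕ) (M : Matroid n)
    (i j : Fin n) → Matroid.IsCircuit M (⁅ i ⁆ ∪ ⁅ j ⁆) →
    (ν ν' : Subset n → G∞ G) → IsValuationOf G M d ν → IsValuationOf G M d ν' →
    DeleteEq G d j ν ν' → Equiv G d ν ν'
lemma5p12 G d M i j circuit ν ν' V V' agree
  with circuitShift G d M i j circuit V V' agree
... | δ , shifted = equivalent-if-shifted G d M V V' j agree δ shifted
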